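{- (Preservation property of GCRs.) Let $G_0\Rightarrow_{\rho_1*_E\rho_2,m}G_2$ be a direct transformation via a concurrent rule $\rho_1*_E\rho_2$, given by the span $G_0\xleftarrow{g_0}D\xrightarrow{g_2}G_2$. For every GCR $\rho_1*_{E,k}\rho_2$ enhancing $\rho_1*_E\rho_2$ there is a direct transformation $G_0\Rightarrow_{\rho_1*_{E,k}\rho_2,m}G_2$, given by a span $G_0\xleftarrow{g_0'}D'\xrightarrow{g_2'}G_2$, and a unique $\mathcal{M}$-morphism $k'':D\to D'$ with $g_i'\circ k''=g_i$ for $i=0,2$. Moreover, $k''$ is an isomorphism if and only if the enhancement morphism $k'$ is one.
   Context: $(\mathcal{C},\mathcal{M})$: $\mathcal{M}$-adhesive category with $\mathcal{E}'$-$\mathcal{M}$ pair factorization (pairs in $\mathcal{E}'$ used are pairs of $\mathcal{M}$-morphisms). A rule $(L\xleftarrow{l}K\xrightarrow{r}R,\mathit{ac})$ has $l,r\in\mathcal{M}$ and nested condition $\mathit{ac}$ over $L$; matches are $\mathcal{M}$-morphisms; a direct transformation at $m:L\to G_0$ with $m\models\mathit{ac}$ is a double pushout $G_0\xleftarrow{g_0}D\xrightarrow{g_2}G_2$ with $d:K\to D$, the squares $(l,d,m,g_0)$ and $(r,d,n,g_2)$ being pushouts. Rules $\rho_i=(L_i\xleftarrow{l_i}K_i\xrightarrow{r_i}R_i,\mathit{ac}_i)$. $E$-dependency relation $(e_1:R_1\to E,e_2:L_2\to E)\in\mathcal{E}'$ with pushout complements $e_1'':K_1\to C_1$, $r_1':C_1\to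 E$ of $e_1\circ r_1$ and $e_2'':K_2\to C_2$, $l_2':C_2\to E$ of $e_2\circ l_2$. Concurrent rule $\rho_1*_E\rho_2=(L\xleftarrow{l}K\xrightarrow{r}R,\mathit{ac})$: $L$ (with $e_1',l_1'$) pushout of $l_1,e_1''$; $R$ (with $e_2',r_2'$) pushout of $r_2,e_2''$; $K$ (with $k_1,k_2$) pullback of $r_1',l_2'$; $l=l_1'\circ k_1$, $r=r_2'\circ k_2$; $\mathit{ac}=\mathrm{Shift}(e_1',\mathit{ac}_1)\wedge\mathrm{Left}((L\xleftarrow{l_1'}C_1\xrightarrow{r_1'}E),\mathrm{Shift}(e_2,\mathit{ac}_2))$ via the standard transports of nested conditions. Common kernel: $\mathcal{M}$-morphism $k:K_\cap\to V$ with $\mathcal{M}$-morphisms $u_i:K_\cap\to K_i$, $v_1:V\to L_1$, $v_2:V\to R_2$ such that $v_1\circ k=l_1\circ u_1$, $v_2\circ k=r_2\circ u_2$ are pullbacks; compatible with $E$ if $(u_1,u_2)$ is a pullback of $(e_1\circ r_1,e_2\circ l_2)$; $p:K_\cap\to K$ is the unique morphism with $k_i\circ p=e_i''\circ u_i$. GCR: $K'$ (with $p':V\to K'$, $k':K\to K'$) the pushout of $k$ along $p$; $l'\circ p'=e_1'\circ v_1$, $l'\circ k'=l$; $r'\circ p'=e_2'\circ v_2$, $r'\circ k'=r$; if $l',r'\in\mathcal{M}$, $\rho_1*_{E,k}\rho_2=(L\xleftarrow{l'}K'\xrightarrow{r'}R,\mathit{ac})$, which enhances $\rho_1*_E\rho_2$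 with enhancement morphism $k'$. -}

module Defs where

open import Level using (Level; _⊔_) renaming (suc to lsuc)
open import Data.Product using (Σ; _×_; _,_)
open import Relation.Binary.Structures using (IsEquivalence)

record Category (o ℓ e : Level) : Set (lsuc (o ⊔ ℓ ⊔ e)) where
  infixr 9 _∘_
  infix 4 _≈_
  field
    Obj : Set o
    _⇒_ : Obj → Obj → Set ℓ
    _≈_ : ∀ {A B} → A ⇒ B → A ⇒ B → Set e
    id : ∀ {A} → A ⇒ A
    _∘_ : ∀ {A B C} → B ⇒ C → A ⇒ B → A ⇒ C
    ≈-equiv : ∀ {A B} → IsEquivalence (_≈_ {A} {B})
    ∘-resp-≈ : ∀ {A B C} {f h : B ⇒ C} {g i : A ⇒ B} → f ≈ h → g ≈ i → f ∘ g ≈ h ∘ i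
    assoc : ∀ {A B C D} {f : A ⇒ B} {g : B ⇒ C} {h : C ⇒ D} → (h ∘ g) ∘ f ≈ h ∘ (g ∘ f)
    identityˡ : ∀ {A B} {f : A ⇒ B} → id ∘ f ≈ f
    identityʳ : ∀ {A B} {f : A ⇒ B} → f ∘ id ≈ f

module Notions {o ℓ e : Level} (𝒞 : Category o ℓ e) where
  open Category 𝒞

  Mono : ∀ {A B} → A ⇒ B → Set (o ⊔ ℓ ⊔ e)
  Mono {A} f = ∀ {X} (g h : X ⇒ A) → f ∘ g ≈ f ∘ h → g ≈ h

  record Iso {A B : Obj} (f : A ⇒ B) : Set (ℓ ⊔ e) where
    field
      inv  : B ⇒ A
      isoˡ : inv ∘ f ≈ id
      isoʳ : f ∘ inv ≈ id

  record IsPushout {A B C D : Obj} (f : A ⇒ B) (g : A ⇒ C) (i₁ : B ⇒ D) (i₂ : C ⇒ D)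
         : Set (o ⊔ ℓ ⊔ e) where
    field
      commute   : i₁ ∘ f ≈ i₂ ∘ g
      universal : ∀ {X} (h₁ : B ⇒ X) (h₂ : C ⇒ X) → h₁ ∘ f ≈ h₂ ∘ g → D ⇒ X
      factor₁   : ∀ {X} (h₁ : B ⇒ X) (h₂ : C ⇒ X) (eq : h₁ ∘ f ≈ h₂ ∘ g) →
                  universal h₁ h₂ eq ∘ i₁ ≈ h₁
      factor₂   : ∀ {X} (h₁ : B ⇒ X) (h₂ : C ⇒ X) (eq : h₁ ∘ f ≈ h₂ ∘ g) →
                  universal h₁ h₂ eq ∘ i₂ ≈ h₂
      unique    : ∀ {X} (h₁ : B ⇒ X) (h₂ : C ⇒ X) (eq : h₁ ∘ f ≈ h₂ ∘ g) (u : D ⇒ X) →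
                  u ∘ i₁ ≈ h₁ → u ∘ i₂ ≈ h₂ → u ≈ universal h₁ h₂ eq

  record IsPullback {P A B Z : Obj} (p₁ : P ⇒ A) (p₂ : P ⇒ B) (f : A ⇒ Z) (g : B ⇒ Z)
         : Set (o ⊔ ℓ ⊔ e) where
    field
      commute   : f ∘ p₁ ≈ g ∘ p₂
      universal : ∀ {X} (h₁ : X ⇒ A) (h₂ : X ⇒ B) → f ∘ h₁ ≈ g ∘ h₂ → X ⇒ P
      factor₁   : ∀ {X} (h₁ : X ⇒ A) (h₂ : X ⇒ B) (eq : f ∘ h₁ ≈ g ∘ h₂) →
                  p₁ ∘ universal h₁ h₂ eq ≈ h₁
      factor₂   : ∀ {X} (h₁ : X ⇒ A) (h₂ : X ⇒ B) (eq : f ∘ h₁ ≈ g ∘ h₂) →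
                  p₂ ∘ universal h₁ h₂ eq ≈ h₂
      unique    : ∀ {X} (h₁ : X ⇒ A) (h₂ : X ⇒ B) (eq : f ∘ h₁ ≈ g ∘ h₂) (u : X ⇒ P) →
                  p₁ ∘ u ≈ h₁ → p₂ ∘ u ≈ h₂ → u ≈ universal h₁ h₂ eq

record MAdhesive {o ℓ e : Level} (𝒞 : Category o ℓ e) (mℓ : Level)
       : Set (lsuc (o ⊔ ℓ ⊔ e ⊔ mℓ)) where
  open Category 𝒞
  open Notions 𝒞
  field
    M : ∀ {A B} → A ⇒ B → Set mℓ
    M-resp-≈ : ∀ {A B} {f g : A ⇒ B} → f ≈ g → M f → M g
    M-mono : ∀ {A B} {f : A ⇒ B} → M f → Mono f
    iso⇒M : ∀ {A B} {f : A ⇒ B} → Iso f → M f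
    M-∘ : ∀ {A B C} {f : A ⇒ B} {g : B ⇒ C} → M f → M g → M (g ∘ f)
    M-decomp : ∀ {A B C} {f : A ⇒ B} {g : B ⇒ C} → M (g ∘ f) → M g → M f
    pushout-along-M : ∀ {A B C} (m : A ⇒ B) (f : A ⇒ C) → M m →
      Σ Obj λ D → Σ (B ⇒ D) λ i₁ → Σ (C ⇒ D) λ i₂ → IsPushout m f i₁ i₂
    M-pushout-stable : ∀ {A B C D} {m : A ⇒ B} {f : A ⇒ C} {i₁ : B ⇒ D} {i₂ : C ⇒ D} →
      IsPushout m f i₁ i₂ → M m → M i₂
    pullback-along-M : ∀ {A B Z} (f : A ⇒ Z) (m : B ⇒ Z) → M m →
      Σ Obj λ P → Σ (P ⇒ A) λ p₁ → Σ (P ⇒ B) λ p₂ → IsPullback p₁ p₂ f m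
    M-pullback-stable : ∀ {P A B Z} {p₁ : P ⇒ A} {p₂ : P ⇒ B} {f : A ⇒ Z} {m : B ⇒ Z} →
      IsPullback p₁ p₂ f m → M m → M p₁
    -- pushouts along M-morphisms are vertical weak van Kampen squares:
    -- bottom face  A -m-> B, A -f-> C, B -n-> D, C -g-> D  (pushout, m ∈ M),
    -- top face     A' -m'-> B', A' -f'-> C', B' -n'-> D', C' -g'-> D',
    -- vertical     a, b, c, d  with b, c, d ∈ M, back faces pullbacks:
    -- top is a pushout iff the front faces are pullbacks.
    vertical-weak-VK :
      ∀ {A B C D} {m : A ⇒ B} {f : A ⇒ C} {n : B ⇒ D} {g : C ⇒ D} →
      IsPushout m f n g → M m →
      ∀ {A' B' C' D'} {m' : A' ⇒ B'} {f' : A' ⇒ C'} {n' : B' ⇒ D'} {g' : C' ⇒ D'}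
        {a : A' ⇒ A} {b : B' ⇒ B} {c : C' ⇒ C} {d : D' ⇒ D} →
      n' ∘ m' ≈ g' ∘ f' →
      m ∘ a ≈ b ∘ m' → f ∘ a ≈ c ∘ f' → n ∘ b ≈ d ∘ n' → g ∘ c ≈ d ∘ g' →
      IsPullback m' a b m → IsPullback f' a c f →
      M b → M c → M d →
      (IsPushout m' f' n' g' → IsPullback n' b d n × IsPullback g' c d g) ×
      (IsPullback n' b d n × IsPullback g' c d g → IsPushout m' f' n' g')

record PairFactorization {o ℓ e mℓ : Level} (𝒞 : Category o ℓ e) (MA : MAdhesive 𝒞 mℓ)
       (eℓ : Level) : Set (lsuc (o ⊔ ℓ ⊔ e ⊔ mℓ ⊔ eℓ)) where
  open Category 𝒞
  open MAdhesive MA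
  field
    E' : ∀ {A₁ A₂ B} → A₁ ⇒ B → A₂ ⇒ B → Set eℓ
    factor : ∀ {A₁ A₂ B} (f₁ : A₁ ⇒ B) (f₂ : A₂ ⇒ B) →
      Σ Obj λ K → Σ (A₁ ⇒ K) λ e₁ → Σ (A₂ ⇒ K) λ e₂ → Σ (K ⇒ B) λ m →
        E' e₁ e₂ × M m × (m ∘ e₁ ≈ f₁) × (m ∘ e₂ ≈ f₂)

module Theory {o ℓ e mℓ eℓ : Level} (𝒞 : Category o ℓ e) (MA : MAdhesive 𝒞 mℓ)
              (PF : PairFactorization 𝒞 MA eℓ) where
  open Category 𝒞
  open Notions 𝒞
  open MAdhesive MA
  open PairFactorization PF

  -- span part of a rule  L <-l- K -r-> R  with l, r ∈ M
  -- (application conditions are treated separately)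
  record Rule : Set (o ⊔ ℓ ⊔ mℓ) where
    field
      L K R : Obj
      l : K ⇒ L
      r : K ⇒ R
      l∈M : M l
      r∈M : M r

  record EDependency (ρ₁ ρ₂ : Rule) : Set (o ⊔ ℓ ⊔ e ⊔ mℓ ⊔ eℓ) where
    open Rule ρ₁ renaming (L to L₁; K to K₁; R to R₁; l to l₁; r to r₁)
    open Rule ρ₂ renaming (L to L₂; K to K₂; R to R₂; l to l₂; r to r₂)
    field
      E : Obj
      e₁ : R₁ ⇒ E
      e₂ : L₂ ⇒ E
      e∈E' : E' e₁ e₂
      e₁∈M : M e₁
      e₂∈M : M e₂
      C₁ : Obj
      e₁'' : K₁ ⇒ C₁
      r₁' : C₁ ⇒ E
      pushout-C₁ : IsPushout r₁ e₁'' e₁ r₁'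
      C₂ : Obj
      e₂'' : K₂ ⇒ C₂
      l₂' : C₂ ⇒ E
      pushout-C₂ : IsPushout l₂ e₂'' e₂ l₂'

  record ConcurrentRule {ρ₁ ρ₂ : Rule} (Ed : EDependency ρ₁ ρ₂) : Set (o ⊔ ℓ ⊔ e) where
    open Rule ρ₁ renaming (L to L₁; K to K₁; R to R₁; l to l₁; r to r₁)
    open Rule ρ₂ renaming (L to L₂; K to K₂; R to R₂; l to l₂; r to r₂)
    open EDependency Ed
    field
      L : Obj
      e₁' : L₁ ⇒ L
      l₁' : C₁ ⇒ L
      pushout-L : IsPushout l₁ e₁'' e₁' l₁'
      R : Obj
      e₂' : R₂ ⇒ R
      r₂' : C₂ ⇒ R
      pushout-R : IsPushout r₂ e₂'' e₂' r₂'
      K : Obj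
      k₁ : K ⇒ C₁
      k₂ : K ⇒ C₂
      pullback-K : IsPullback k₁ k₂ r₁' l₂'
    l : K ⇒ L
    l = l₁' ∘ k₁
    r : K ⇒ R
    r = r₂' ∘ k₂

  record CommonKernel (ρ₁ ρ₂ : Rule) : Set (o ⊔ ℓ ⊔ e ⊔ mℓ) where
    open Rule ρ₁ renaming (L to L₁; K to K₁; R to R₁; l to l₁; r to r₁)
    open Rule ρ₂ renaming (L to L₂; K to K₂; R to R₂; l to l₂; r to r₂)
    field
      K∩ V : Obj
      k : K∩ ⇒ V
      u₁ : K∩ ⇒ K₁
      u₂ : K∩ ⇒ K₂
      v₁ : V ⇒ L₁
      v₂ : V ⇒ R₂
      k∈M : M k
      u₁∈M : M u₁
      u₂∈M : M u₂
      v₁∈M : M v₁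
      v₂∈M : M v₂
      pullback₁ : IsPullback k u₁ v₁ l₁
      pullback₂ : IsPullback k u₂ v₂ r₂

  Compatible : {ρ₁ ρ₂ : Rule} → EDependency ρ₁ ρ₂ → CommonKernel ρ₁ ρ₂ → Set (o ⊔ ℓ ⊔ e)
  Compatible {ρ₁} {ρ₂} Ed ck =
    IsPullback (CommonKernel.u₁ ck) (CommonKernel.u₂ ck)
               (EDependency.e₁ Ed ∘ Rule.r ρ₁) (EDependency.e₂ Ed ∘ Rule.l ρ₂)

  record GCR {ρ₁ ρ₂ : Rule} (Ed : EDependency ρ₁ ρ₂) (Cr : ConcurrentRule Ed)
             (ck : CommonKernel ρ₁ ρ₂) : Set (o ⊔ ℓ ⊔ e ⊔ mℓ) where
    open EDependency Ed
    open ConcurrentRule Cr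
    open CommonKernel ck
    field
      compatible : Compatible Ed ck
      p : K∩ ⇒ K
      p-eq₁ : k₁ ∘ p ≈ e₁'' ∘ u₁
      p-eq₂ : k₂ ∘ p ≈ e₂'' ∘ u₂
      K' : Obj
      p' : V ⇒ K'
      k' : K ⇒ K'
      pushout-K' : IsPushout k p p' k'
      l' : K' ⇒ L
      l'-eq₁ : l' ∘ p' ≈ e₁' ∘ v₁
      l'-eq₂ : l' ∘ k' ≈ l
      r' : K' ⇒ R
      r'-eq₁ : r' ∘ p' ≈ e₂' ∘ v₂
      r'-eq₂ : r' ∘ k' ≈ r
      l'∈M : M l'
      r'∈M : M r'

  -- a direct transformation G₀ ⇒ G₂ via the rule (L <-l- K -r-> R, ac) at
  -- the match m, where  Sat  is the satisfaction predicate  (_⊨ ac).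
  record DirectTransformation {sℓ : Level} {L K R : Obj} (l : K ⇒ L) (r : K ⇒ R)
         (Sat : ∀ {G} → L ⇒ G → Set sℓ) {G₀ : Obj} (m : L ⇒ G₀) (G₂ : Obj)
         : Set (o ⊔ ℓ ⊔ e ⊔ mℓ ⊔ sℓ) where
    field
      D : Obj
      d : K ⇒ D
      n : R ⇒ G₂
      g₀ : D ⇒ G₀
      g₂ : D ⇒ G₂
      pushout-left : IsPushout l d m g₀
      pushout-right : IsPushout r d n g₂
      m∈M : M m
      m⊨ac : Sat m

-- Since l = l' ∘ k' and r = r' ∘ k', each pushout square of the DPO for ρ₁ *_E ρ₂ splits into
-- the pushout D' of k' along d followed by a square for the GCR, and that square is a pushout
-- by pushout decomposition; k'' : D → D' is the pushout of k' ∈ M and hence lies in M. It is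
-- unique because g₀' is the pushout of l' ∈ M, hence monic. Finally, pushouts along M are
-- pullbacks, so k' is also a pullback of k''; isomorphisms are stable under both pushouts
-- and pullbacks, so k'' is an isomorphism iff k' is.
module Submission where

open import Defs
open import Level using (Level)
open import Data.Product using (Σ; _×_; _,_; proj₁; proj₂)
open import Relation.Binary.Bundles using (Setoid)
open import Relation.Binary.Structures using (IsEquivalence)
import Relation.Binary.Reasoning.Setoid as SetoidReasoning

module CategoryProperties {o ℓ e : Level} (𝒞 : Category o ℓ e) where
  open Category 𝒞
  open Notions 𝒞
  module ≈ {A B} = IsEquivalence (≈-equiv {A} {B})
  open ≈ public using (refl; sym; trans)

  hom-setoid : Obj → Obj → Setoid ℓ e
  hom-setoid A B = record { Carrier = A ⇒ B ; _≈_ = _≈_ ; isEquivalence = ≈-equiv }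

  module HomReasoning {A B} = SetoidReasoning (hom-setoid A B)
  open HomReasoning

  infixr 4 _⟩∘⟨_
  _⟩∘⟨_ : ∀ {A B C} {f h : B ⇒ C} {g i : A ⇒ B} → f ≈ h → g ≈ i → f ∘ g ≈ h ∘ i
  _⟩∘⟨_ = ∘-resp-≈

  pullˡ : ∀ {A B C D} {a : C ⇒ D} {b : B ⇒ C} {c : B ⇒ D} {f : A ⇒ B} →
          a ∘ b ≈ c → a ∘ (b ∘ f) ≈ c ∘ f
  pullˡ ab≈c = trans (sym assoc) (ab≈c ⟩∘⟨ refl)

  pullʳ : ∀ {A B C D} {a : B ⇒ C} {b : A ⇒ B} {c : A ⇒ C} {f : C ⇒ D} →
          a ∘ b ≈ c → (f ∘ a) ∘ b ≈ f ∘ c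
  pullʳ ab≈c = trans assoc (refl ⟩∘⟨ ab≈c)

  extendˡ : ∀ {A B B' C D} {a : B ⇒ D} {b : C ⇒ B} {c : B' ⇒ D} {d : C ⇒ B'} {f : A ⇒ C} →
            a ∘ b ≈ c ∘ d → a ∘ (b ∘ f) ≈ c ∘ (d ∘ f)
  extendˡ square = trans (pullˡ square) assoc

  extendʳ : ∀ {A B B' C D} {a : B ⇒ C} {b : A ⇒ B} {c : B' ⇒ C} {d : A ⇒ B'} {f : C ⇒ D} →
            a ∘ b ≈ c ∘ d → (f ∘ a) ∘ b ≈ (f ∘ c) ∘ d
  extendʳ square = trans (pullʳ square) (sym assoc)

  id-Iso : ∀ {A} → Iso (id {A})
  id-Iso = record { inv = id ; isoˡ = identityˡ ; isoʳ = identityˡ }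

  id-pushout : ∀ {A C} (f : A ⇒ C) → IsPushout id f f id
  id-pushout f = record
    { commute = trans identityʳ (sym identityˡ)
    ; universal = λ _ h₂ _ → h₂
    ; factor₁ = λ _ _ eq → trans (sym eq) identityʳ
    ; factor₂ = λ _ _ _ → identityʳ
    ; unique = λ _ _ _ _ _ q → trans (sym identityʳ) q
    }

  id-pullback : ∀ {A C} (f : A ⇒ C) → IsPullback f id id f
  id-pullback f = record
    { commute = trans identityˡ (sym identityʳ)
    ; universal = λ _ h₂ _ → h₂
    ; factor₁ = λ _ _ eq → trans (sym eq) identityˡ
    ; factor₂ = λ _ _ _ → identityˡ
    ; unique = λ _ _ _ _ _ q → trans (sym identityˡ) q
    }

  Mono⇒kernel-pair-id : ∀ {A B} {m : A ⇒ B} → Mono m → IsPullback id id m m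
  Mono⇒kernel-pair-id m-mono = record
    { commute = refl
    ; universal = λ h₁ _ _ → h₁
    ; factor₁ = λ _ _ _ → identityˡ
    ; factor₂ = λ h₁ h₂ eq → trans identityˡ (m-mono h₁ h₂ eq)
    ; unique = λ _ _ _ _ p _ → trans (sym identityˡ) p
    }

  pushout-jointly-epic : ∀ {A B C D X} {f : A ⇒ B} {g : A ⇒ C} {i₁ : B ⇒ D} {i₂ : C ⇒ D} →
    IsPushout f g i₁ i₂ → {u v : D ⇒ X} → u ∘ i₁ ≈ v ∘ i₁ → u ∘ i₂ ≈ v ∘ i₂ → u ≈ v
  pushout-jointly-epic {f = f} {g} {i₁} {i₂} po {u} {v} p q =
    trans (unique (v ∘ i₁) (v ∘ i₂) v-cocone u p q) (sym (unique _ _ v-cocone v refl refl))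
    where
      open IsPushout po
      v-cocone : (v ∘ i₁) ∘ f ≈ (v ∘ i₂) ∘ g
      v-cocone = extendʳ commute

  pullback-jointly-monic : ∀ {P A B Z X} {p₁ : P ⇒ A} {p₂ : P ⇒ B} {f : A ⇒ Z} {g : B ⇒ Z} →
    IsPullback p₁ p₂ f g → {u v : X ⇒ P} → p₁ ∘ u ≈ p₁ ∘ v → p₂ ∘ u ≈ p₂ ∘ v → u ≈ v
  pullback-jointly-monic {p₁ = p₁} {p₂} {f} {g} pb {u} {v} p q =
    trans (unique (p₁ ∘ v) (p₂ ∘ v) v-cone u p q) (sym (unique _ _ v-cone v refl refl))
    where
      open IsPullback pb
      v-cone : f ∘ (p₁ ∘ v) ≈ g ∘ (p₂ ∘ v)
      v-cone = extendˡ commute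

  pushout-decompose : ∀ {A B C P Q X} {a : A ⇒ B} {b : A ⇒ C} {c : B ⇒ P} {x : C ⇒ P}
    {f : B ⇒ Q} {h : A ⇒ Q} {i₁ : Q ⇒ X} {y : C ⇒ X} {g' : P ⇒ X} →
    IsPushout a b c x → IsPushout h b i₁ y → f ∘ a ≈ h →
    g' ∘ c ≈ i₁ ∘ f → g' ∘ x ≈ y → IsPushout f c i₁ g'
  pushout-decompose {P = P} {Q} {X} {a} {b} {c} {x} {f} {h} {i₁} {y} {g'}
                    left outer fa≈h g'c≈i₁f g'x≈y = record
    { commute = sym g'c≈i₁f
    ; universal = λ h₁ h₂ eq → O.universal h₁ (h₂ ∘ x) (outer-cocone h₁ h₂ eq)
    ; factor₁ = λ h₁ h₂ eq → O.factor₁ h₁ (h₂ ∘ x) (outer-cocone h₁ h₂ eq)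
    ; factor₂ = factor₂
    ; unique = λ h₁ h₂ eq u p q →
        O.unique h₁ (h₂ ∘ x) (outer-cocone h₁ h₂ eq) u p
          (trans (refl ⟩∘⟨ sym g'x≈y) (pullˡ q))
    }
    where
      module S = IsPushout left
      module O = IsPushout outer
      outer-cocone : ∀ {Z} (h₁ : Q ⇒ Z) (h₂ : P ⇒ Z) → h₁ ∘ f ≈ h₂ ∘ c → h₁ ∘ h ≈ (h₂ ∘ x) ∘ b
      outer-cocone h₁ h₂ eq = begin
        h₁ ∘ h        ≈⟨ refl ⟩∘⟨ sym fa≈h ⟩
        h₁ ∘ (f ∘ a)  ≈⟨ pullˡ eq ⟩
        (h₂ ∘ c) ∘ a  ≈⟨ extendʳ S.commute ⟩
        (h₂ ∘ x) ∘ b  ∎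
      factor₂ : ∀ {Z} (h₁ : Q ⇒ Z) (h₂ : P ⇒ Z) (eq : h₁ ∘ f ≈ h₂ ∘ c) →
                O.universal h₁ (h₂ ∘ x) (outer-cocone h₁ h₂ eq) ∘ g' ≈ h₂
      factor₂ {Z} h₁ h₂ eq = pushout-jointly-epic left
        (begin
          (u ∘ g') ∘ c  ≈⟨ pullʳ g'c≈i₁f ⟩
          u ∘ (i₁ ∘ f)  ≈⟨ pullˡ (O.factor₁ h₁ (h₂ ∘ x) (outer-cocone h₁ h₂ eq)) ⟩
          h₁ ∘ f        ≈⟨ eq ⟩
          h₂ ∘ c        ∎)
        (trans (pullʳ g'x≈y) (O.factor₂ h₁ (h₂ ∘ x) (outer-cocone h₁ h₂ eq)))
        where
          u : X ⇒ Z
          u = O.universal h₁ (h₂ ∘ x) (outer-cocone h₁ h₂ eq)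

  pushout-along-composite-factors : ∀ {K K' L D D' G} {k' : K ⇒ K'} {d : K ⇒ D}
    {d' : K' ⇒ D'} {k'' : D ⇒ D'} {l : K ⇒ L} {l' : K' ⇒ L} {m : L ⇒ G} {g : D ⇒ G} →
    IsPushout k' d d' k'' → IsPushout l d m g → l' ∘ k' ≈ l →
    Σ (D' ⇒ G) λ g' → IsPushout l' d' m g' × (g' ∘ k'' ≈ g)
  pushout-along-composite-factors {k' = k'} {d} {l' = l'} {m} {g} D' outer l'k'≈l =
    D'.universal (m ∘ l') g cocone ,
    pushout-decompose D' outer l'k'≈l (D'.factor₁ (m ∘ l') g cocone) (D'.factor₂ (m ∘ l') g cocone) ,
    D'.factor₂ (m ∘ l') g cocone
    where
      module D' = IsPushout D'
      cocone : (m ∘ l') ∘ k' ≈ g ∘ d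
      cocone = trans (pullʳ l'k'≈l) (IsPushout.commute outer)

  Iso-pushout-stable : ∀ {A B C D} {a : A ⇒ B} {b : A ⇒ C} {c : B ⇒ D} {x : C ⇒ D} →
    IsPushout a b c x → Iso a → Iso x
  Iso-pushout-stable {C = C} {D} {a} {b} {c} {x} po a-iso = record
    { inv = x⁻¹
    ; isoˡ = factor₂ (b ∘ a⁻¹) id cocone
    ; isoʳ = pushout-jointly-epic po
        (begin
          (x ∘ x⁻¹) ∘ c    ≈⟨ pullʳ (factor₁ (b ∘ a⁻¹) id cocone) ⟩
          x ∘ (b ∘ a⁻¹)    ≈⟨ pullˡ (sym commute) ⟩
          (c ∘ a) ∘ a⁻¹    ≈⟨ pullʳ a∘a⁻¹≈id ⟩
          c ∘ id           ≈⟨ identityʳ ⟩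
          c                ≈⟨ sym identityˡ ⟩
          id ∘ c           ∎)
        (trans (pullʳ (factor₂ (b ∘ a⁻¹) id cocone)) (trans identityʳ (sym identityˡ)))
    }
    where
      open IsPushout po
      open Iso a-iso renaming (inv to a⁻¹; isoˡ to a⁻¹∘a≈id; isoʳ to a∘a⁻¹≈id)
      cocone : (b ∘ a⁻¹) ∘ a ≈ id ∘ b
      cocone = trans (pullʳ a⁻¹∘a≈id) (trans identityʳ (sym identityˡ))
      x⁻¹ : D ⇒ C
      x⁻¹ = universal (b ∘ a⁻¹) id cocone

  Iso-pullback-stable : ∀ {P A B Z} {p₁ : P ⇒ A} {p₂ : P ⇒ B} {f : A ⇒ Z} {g : B ⇒ Z} →
    IsPullback p₁ p₂ f g → Iso f → Iso p₂
  Iso-pullback-stable {P} {B = B} {p₁ = p₁} {p₂} {f} {g} pb f-iso = record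
    { inv = p₂⁻¹
    ; isoˡ = pullback-jointly-monic pb
        (begin
          p₁ ∘ (p₂⁻¹ ∘ p₂)  ≈⟨ pullˡ (factor₁ (f⁻¹ ∘ g) id cone) ⟩
          (f⁻¹ ∘ g) ∘ p₂    ≈⟨ pullʳ (sym commute) ⟩
          f⁻¹ ∘ (f ∘ p₁)    ≈⟨ pullˡ f⁻¹∘f≈id ⟩
          id ∘ p₁           ≈⟨ identityˡ ⟩
          p₁                ≈⟨ sym identityʳ ⟩
          p₁ ∘ id           ∎)
        (trans (pullˡ (factor₂ (f⁻¹ ∘ g) id cone)) (trans identityˡ (sym identityʳ)))
    ; isoʳ = factor₂ (f⁻¹ ∘ g) id cone
    }
    where
      open IsPullback pb
      open Iso f-iso renaming (inv to f⁻¹; isoˡ to f⁻¹∘f≈id; isoʳ to f∘f⁻¹≈id)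
      cone : f ∘ (f⁻¹ ∘ g) ≈ g ∘ id
      cone = trans (pullˡ f∘f⁻¹≈id) (trans identityˡ (sym identityʳ))
      p₂⁻¹ : B ⇒ P
      p₂⁻¹ = universal (f⁻¹ ∘ g) id cone

module MAdhesiveProperties {o ℓ e mℓ : Level} (𝒞 : Category o ℓ e) (MA : MAdhesive 𝒞 mℓ) where
  open Category 𝒞
  open Notions 𝒞
  open MAdhesive MA
  open CategoryProperties 𝒞

  -- Van Kampen applied to the cube whose top face is the trivial pushout (id, f, f, id)
  -- and whose vertical edges are id, m, id and g.
  M-pushout⇒pullback : ∀ {A B C D} {m : A ⇒ B} {f : A ⇒ C} {n : B ⇒ D} {g : C ⇒ D} →
    IsPushout m f n g → M m → IsPullback f m g n
  M-pushout⇒pullback {f = f} po m∈M =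
    proj₁ (proj₁ (vertical-weak-VK po m∈M
      (IsPushout.commute (id-pushout f))
      refl (trans identityʳ (sym identityˡ)) (IsPushout.commute po) refl
      (Mono⇒kernel-pair-id (M-mono m∈M)) (id-pullback f)
      m∈M (iso⇒M id-Iso) (M-pushout-stable po m∈M))
      (id-pushout f))

module DoublePushoutProperties
  {o ℓ e mℓ eℓ : Level} (𝒞 : Category o ℓ e) (MA : MAdhesive 𝒞 mℓ)
  (PF : PairFactorization 𝒞 MA eℓ) where
  open Category 𝒞
  open Notions 𝒞
  open MAdhesive MA
  open Theory 𝒞 MA PF
  open CategoryProperties 𝒞
  open MAdhesiveProperties 𝒞 MA

  module AlongEnhancement {L K K' R : Obj} {l : K ⇒ L} {r : K ⇒ R} {l' : K' ⇒ L} {r' : K' ⇒ R}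
           {k' : K ⇒ K'} (k'∈M : M k') (l'∈M : M l')
           (l'∘k'≈l : l' ∘ k' ≈ l) (r'∘k'≈r : r' ∘ k' ≈ r)
           {sℓ : Level} {Sat : ∀ {G} → L ⇒ G → Set sℓ} {G₀ G₂ : Obj} {m : L ⇒ G₀}
           (T : DirectTransformation l r Sat m G₂) where
    private
      module T = DirectTransformation T

      D' : Obj
      D' = proj₁ (pushout-along-M k' T.d k'∈M)

      d' : K' ⇒ D'
      d' = proj₁ (proj₂ (pushout-along-M k' T.d k'∈M))

    k'' : T.D ⇒ D'
    k'' = proj₁ (proj₂ (proj₂ (pushout-along-M k' T.d k'∈M)))

    k''-square : IsPushout k' T.d d' k''
    k''-square = proj₂ (proj₂ (proj₂ (pushout-along-M k' T.d k'∈M)))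

    private
      left : Σ (D' ⇒ G₀) λ g₀' → IsPushout l' d' m g₀' × (g₀' ∘ k'' ≈ T.g₀)
      left = pushout-along-composite-factors k''-square T.pushout-left l'∘k'≈l

      right : Σ (D' ⇒ G₂) λ g₂' → IsPushout r' d' T.n g₂' × (g₂' ∘ k'' ≈ T.g₂)
      right = pushout-along-composite-factors k''-square T.pushout-right r'∘k'≈r

    enhanced : DirectTransformation l' r' Sat m G₂
    enhanced = record
      { D = D' ; d = d' ; n = T.n ; g₀ = proj₁ left ; g₂ = proj₁ right
      ; pushout-left = proj₁ (proj₂ left) ; pushout-right = proj₁ (proj₂ right)
      ; m∈M = T.m∈M ; m⊨ac = T.m⊨ac }

    open DirectTransformation enhanced using () renaming (g₀ to g₀'; g₂ to g₂')

    k''∈M : M k''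
    k''∈M = M-pushout-stable k''-square k'∈M

    g₀'∘k''≈g₀ : g₀' ∘ k'' ≈ T.g₀
    g₀'∘k''≈g₀ = proj₂ (proj₂ left)

    g₂'∘k''≈g₂ : g₂' ∘ k'' ≈ T.g₂
    g₂'∘k''≈g₂ = proj₂ (proj₂ right)

    k''-unique : ∀ (h : T.D ⇒ D') → g₀' ∘ h ≈ T.g₀ → h ≈ k''
    k''-unique h g₀'∘h≈g₀ =
      M-mono (M-pushout-stable (proj₁ (proj₂ left)) l'∈M) h k'' (trans g₀'∘h≈g₀ (sym g₀'∘k''≈g₀))

    Iso-k''⇒Iso-k' : Iso k'' → Iso k'
    Iso-k''⇒Iso-k' = Iso-pullback-stable (M-pushout⇒pullback k''-square k'∈M)

    Iso-k'⇒Iso-k'' : Iso k' → Iso k''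
    Iso-k'⇒Iso-k'' = Iso-pushout-stable k''-square

proposition5 : ∀ {o ℓ e mℓ eℓ sℓ : Level}
    (𝒞 : Category o ℓ e) (MA : MAdhesive 𝒞 mℓ) (PF : PairFactorization 𝒞 MA eℓ) →
    let open Category 𝒞
        open Notions 𝒞
        open MAdhesive MA
        open Theory 𝒞 MA PF
    in
    (ρ₁ ρ₂ : Rule) (Ed : EDependency ρ₁ ρ₂) (Cr : ConcurrentRule Ed)
    (Sat : ∀ {G} → ConcurrentRule.L Cr ⇒ G → Set sℓ)
    {G₀ G₂ : Obj} (m : ConcurrentRule.L Cr ⇒ G₀)
    (T : DirectTransformation (ConcurrentRule.l Cr) (ConcurrentRule.r Cr) Sat m G₂)
    (ck : CommonKernel ρ₁ ρ₂) (gcr : GCR Ed Cr ck) →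
    Σ (DirectTransformation (GCR.l' gcr) (GCR.r' gcr) Sat m G₂) λ T' →
    Σ (DirectTransformation.D T ⇒ DirectTransformation.D T') λ k'' →
      M k''
      × (DirectTransformation.g₀ T' ∘ k'' ≈ DirectTransformation.g₀ T)
      × (DirectTransformation.g₂ T' ∘ k'' ≈ DirectTransformation.g₂ T)
      × (∀ (h : DirectTransformation.D T ⇒ DirectTransformation.D T') → M h →
           DirectTransformation.g₀ T' ∘ h ≈ DirectTransformation.g₀ T →
           DirectTransformation.g₂ T' ∘ h ≈ DirectTransformation.g₂ T →
           h ≈ k'')
      × (Iso k'' → Iso (GCR.k' gcr))
      × (Iso (GCR.k' gcr) → Iso k'')
proposition5 𝒞 MA PF ρ₁ ρ₂ Ed Cr Sat m T ck gcr =
  enhanced , k'' , k''∈M , g₀'∘k''≈g₀ , g₂'∘k''≈g₂ ,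
  (λ h _ g₀'∘h≈g₀ _ → k''-unique h g₀'∘h≈g₀) , Iso-k''⇒Iso-k' , Iso-k'⇒Iso-k''
  where
    open Theory 𝒞 MA PF using (module GCR; module CommonKernel)
    open GCR gcr using (pushout-K'; l'∈M; l'-eq₂; r'-eq₂)
    k'∈M : MAdhesive.M MA (GCR.k' gcr)
    k'∈M = MAdhesive.M-pushout-stable MA pushout-K' (CommonKernel.k∈M ck)
    open DoublePushoutProperties 𝒞 MA PF
    open AlongEnhancement k'∈M l'∈M l'-eq₂ r'-eq₂ T
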